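{- Let $G$ be a graph on the vertex set $[n]=\{1,\dots,n\}$. For each vertex $i$ let $\alpha_i$ denote the maximum size of an independent set of $G$ that contains $i$. Then every bipartite covering $\mathcal H$ of $G$ satisfies $$\mathrm{cap}(\mathcal H)\ \ge\ \sum_{i=1}^n \log_2\Big(\frac{n}{\alpha_i}\Big).$$
   Context: A bipartite covering of a graph $G$ on vertex set $[n]$ is a finite collection $\mathcal H=\{H_1,\dots,H_m\}$ of bipartite graphs, each with vertex set $V(H_i)\subseteq [n]$ (each $H_i$ is a bipartite subgraph of the complete graph on $[n]$, not necessarily a subgraph of $G$), such that every edge of $G$ is an edge of at least one $H_i$. Its capacity is $\mathrm{cap}(\mathcal H)=\sum_{i=1}^m |V(H_i)|$. -}

module Defs where

open import Data.Nat using (ℕ; _≤_; _+_)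
open import Data.Bool using (Bool; true; false)
open import Data.Fin using (Fin)
open import Data.Fin.Subset using (Subset; _∈_; ∣_∣)
open import Data.List using (List; map)
open import Data.Nat.ListAction using (sum)
open import Data.List.Relation.Unary.Any using (Any)
open import Data.Product using (Σ; _×_)
open import Relation.Binary.PropositionalEquality using (_≡_; _≢_)

record Graph (n : ℕ) : Set where
  field
    adj   : Fin n → Fin n → Bool
    sym   : ∀ i j → adj i j ≡ adj j i
    irrefl : ∀ i → adj i i ≡ false

record BipGraph (n : ℕ) : Set where
  field
    verts : Subset n
    adj   : Fin n → Fin n → Bool
    side  : Fin n → Bool
    sym   : ∀ i j → adj i j ≡ adj j i
    edge-in  : ∀ i j → adj i j ≡ true → (i ∈ verts) × (j ∈ verts)
    edge-bip : ∀ i j → adj i j ≡ true → side i ≢ side j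

IsBipCovering : ∀ {n} → Graph n → List (BipGraph n) → Set
IsBipCovering {n} G Hs =
  ∀ (i j : Fin n) → Graph.adj G i j ≡ true → Any (λ H → BipGraph.adj H i j ≡ true) Hs

cap : ∀ {n} → List (BipGraph n) → ℕ
cap Hs = sum (map (λ H → ∣ BipGraph.verts H ∣) Hs)

Independent : ∀ {n} → Graph n → Subset n → Set
Independent {n} G S = ∀ (i j : Fin n) → i ∈ S → j ∈ S → Graph.adj G i j ≡ false

IsMaxIndepThrough : ∀ {n} → Graph n → Fin n → ℕ → Set
IsMaxIndepThrough {n} G i a =
  Σ (Subset n) (λ S → Independent G S × i ∈ S × ∣ S ∣ ≡ a)
  × (∀ (S : Subset n) → Independent G S → i ∈ S → ∣ S ∣ ≤ a)

-- Choose one side of every H ∈ Hs and delete the vertices on the chosen sides. Whatever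
-- survives is independent in G, since every edge of G lies in some H and then loses an endpoint;
-- a vertex v survives 2 ^ (m - d v) of the 2 ^ m choices, where m = length Hs and d v is the
-- number of H containing v. Give v the weight w v = ∏_{u ≠ v} α u: an independent S satisfies
-- ∣ S ∣ ≤ α v for all v ∈ S, so its weight is at most ∏ α, and averaging over the choices gives
-- Σ_v 2 ^ (m - d v) · w v ≤ 2 ^ m · ∏ α. As Σ_v d v = cap Hs, AM–GM for the n numbers
-- 2 ^ (m - d v) · w v turns this into n ^ n ≤ 2 ^ cap Hs · ∏ α.

{-# OPTIONS --safe #-}
module Submission where

open import Defs
open import Data.Nat using (ℕ; zero; suc; _+_; _*_; _^_; _≤_; z≤n; NonZero; >-nonZero)
open import Data.Nat.Properties
open import Data.Nat.ListAction using (product)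
open import Data.Nat.Tactic.RingSolver using (solve-∀)
open import Data.Bool using (Bool; true; false; not; _∨_; _∧_; _xor_; if_then_else_)
open import Data.Bool.Properties using (∧-conicalˡ; ∧-conicalʳ)
open import Data.Fin using (Fin; zero; suc)
open import Data.Fin.Subset using (Subset; _∈_; ∣_∣; ⁅_⁆)
open import Data.Fin.Subset.Properties using (∣⁅x⁆∣≡1; x∈⁅x⁆; x∈⁅y⁆⇒x≡y)
open import Data.List as List using (List; []; _∷_; length; map; allFin)
open import Data.List.Properties using (map-tabulate)
open import Data.List.Relation.Unary.Any using (Any; here; there)
open import Data.List.Relation.Unary.Any.Properties using (¬Any[])
open import Data.Vec as Vec using (lookup)
open import Data.Vec.Functional using (removeAt)
open import Data.Vec.Properties using ([]=⇒lookup; lookup⇒[]=; lookup∘tabulate)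
open import Data.Product using (_,_; proj₁; proj₂)
open import Data.Sum using ([_,_]′)
open import Data.Empty using (⊥-elim)
open import Function using (_∘_; id; const)
open import Relation.Nullary using (contradiction)
open import Relation.Binary.PropositionalEquality
open import Algebra.Properties.CommutativeMonoid.Sum +-0-commutativeMonoid
  using (∑-distrib-+) renaming (sum to ∑; sum-cong-≗ to ∑-cong)
open import Algebra.Properties.CommutativeMonoid.Sum *-1-commutativeMonoid
  using () renaming (sum to ∏; sum-cong-≗ to ∏-cong; ∑-distrib-+ to ∏-distrib-*; sum-remove to ∏-remove)
open import Algebra.Properties.Semiring.Sum +-*-semiring using (*-distribˡ-sum)

2*m*n≤m*m+n*n : ∀ m n → 2 * (m * n) ≤ m * m + n * n
2*m*n≤m*m+n*n m n = [ ordered , flipped ∘ ordered ]′ (≤-total m n)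
  where
  ordered : ∀ {u v} → u ≤ v → 2 * (u * v) ≤ u * u + v * v
  ordered {u} u≤v with d , refl ← m≤n⇒∃[o]m+o≡n u≤v =
    ≤-trans (m≤m+n (2 * (u * (u + d))) (d * d)) (≤-reflexive (square u d))
    where
    square : ∀ u d → 2 * (u * (u + d)) + d * d ≡ u * u + (u + d) * (u + d)
    square = solve-∀
  flipped : 2 * (n * m) ≤ n * n + m * m → 2 * (m * n) ≤ m * m + n * n
  flipped = subst₂ _≤_ (cong (2 *_) (*-comm n m)) (+-comm (n * n) (m * m))

weighted-AM-GM : ∀ k u v → suc k * u * v ^ k ≤ u ^ suc k + k * v ^ suc k
weighted-AM-GM zero    u v = ≤-reflexive (base u v)
  where
  base : ∀ u v → 1 * u * 1 ≡ u * 1 + 0 * (v * 1)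
  base = solve-∀
weighted-AM-GM (suc k) u v = +-cancelʳ-≤ (k * u * (v * p)) _ _ (begin
  suc (suc k) * u * (v * p) + k * u * (v * p)        ≡⟨ regroup₁ k u v p ⟩
  (suc k * p) * (2 * (u * v))                        ≤⟨ *-monoʳ-≤ (suc k * p) (2*m*n≤m*m+n*n u v) ⟩
  (suc k * p) * (u * u + v * v)                      ≡⟨ regroup₂ k u v p ⟩
  u * (suc k * u * p) + suc k * (v * (v * p))        ≤⟨ +-monoˡ-≤ _ (*-monoʳ-≤ u (weighted-AM-GM k u v)) ⟩
  u * (u ^ suc k + k * (v * p)) + suc k * (v * (v * p)) ≡⟨ regroup₃ k u v p (u ^ k) ⟩
  u * (u * u ^ k) + suc k * (v * (v * p)) + k * u * (v * p) ∎)
  where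
  open ≤-Reasoning
  p = v ^ k
  regroup₁ : ∀ k u v p → suc (suc k) * u * (v * p) + k * u * (v * p) ≡ (suc k * p) * (2 * (u * v))
  regroup₁ = solve-∀
  regroup₂ : ∀ k u v p → (suc k * p) * (u * u + v * v) ≡ u * (suc k * u * p) + suc k * (v * (v * p))
  regroup₂ = solve-∀
  regroup₃ : ∀ k u v p q → u * (u * q + k * (v * p)) + suc k * (v * (v * p)) ≡ u * (u * q) + suc k * (v * (v * p)) + k * u * (v * p)
  regroup₃ = solve-∀

^-distribʳ-* : ∀ m n o → (m * n) ^ o ≡ m ^ o * n ^ o
^-distribʳ-* m n zero    = refl
^-distribʳ-* m n (suc o) = trans (cong (m * n *_) (^-distribʳ-* m n o)) (interchange m n (m ^ o) (n ^ o))
  where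
  interchange : ∀ a b c d → a * b * (c * d) ≡ a * c * (b * d)
  interchange = solve-∀

AM-GM-step : ∀ n s y → suc n ^ suc n * (s ^ n * y) ≤ n ^ n * (y + s) ^ suc n
AM-GM-step zero    s y = subst₂ _≤_ (lhs s y) (rhs s y) (m≤m+n y s)
  where
  lhs : ∀ s y → y ≡ 1 * 1 * (1 * y)
  lhs = solve-∀
  rhs : ∀ s y → y + s ≡ 1 * ((y + s) * 1)
  rhs = solve-∀
-- The weighted AM–GM inequality at u = N (y + s), v = (N + 1) s.
AM-GM-step (suc n) s y = *-cancelˡ-≤ N (begin
  N * (suc N ^ suc N * (s ^ N * y))  ≡⟨ regroup N y (suc N ^ N) (s ^ N) ⟩
  N * (suc N * y * (suc N ^ N * s ^ N)) ≡⟨ cong (λ z → N * (suc N * y * z)) (^-distribʳ-* (suc N) s N) ⟨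
  N * (suc N * y * v ^ N)            ≤⟨ +-cancelʳ-≤ (N * v ^ suc N) _ _ weighted ⟩
  u ^ suc N                          ≡⟨ ^-distribʳ-* N (y + s) (suc N) ⟩
  N * N ^ N * (y + s) ^ suc N        ≡⟨ *-assoc N (N ^ N) _ ⟩
  N * (N ^ N * (y + s) ^ suc N)      ∎)
  where
  open ≤-Reasoning
  N = suc n
  u = N * (y + s)
  v = suc N * s
  regroup : ∀ N y a b → N * (suc N * a * (b * y)) ≡ N * (suc N * y * (a * b))
  regroup = solve-∀
  split : ∀ N y s p → suc N * (N * (y + s)) * p ≡ N * (suc N * y * p) + N * (suc N * s * p)
  split = solve-∀
  weighted : N * (suc N * y * v ^ N) + N * v ^ suc N ≤ u ^ suc N + N * v ^ suc N
  weighted = ≤-trans (≤-reflexive (sym (split N y s (v ^ N)))) (weighted-AM-GM N u v)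

n^n≢0 : ∀ n → NonZero (n ^ n)
n^n≢0 zero    = _
n^n≢0 (suc n) = m^n≢0 (suc n) (suc n)

AM-GM : ∀ n (y : Fin n → ℕ) → n ^ n * ∏ y ≤ ∑ y ^ n
AM-GM zero    y = ≤-refl
AM-GM (suc n) y = *-cancelˡ-≤ (n ^ n) {{n^n≢0 n}} (begin
  n ^ n * (suc n ^ suc n * (y zero * ∏ t)) ≡⟨ regroup (n ^ n) (suc n ^ suc n) (y zero) (∏ t) ⟩
  suc n ^ suc n * (n ^ n * ∏ t * y zero)   ≤⟨ *-monoʳ-≤ (suc n ^ suc n) (*-monoˡ-≤ (y zero) (AM-GM n t)) ⟩
  suc n ^ suc n * (∑ t ^ n * y zero)       ≤⟨ AM-GM-step n (∑ t) (y zero) ⟩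
  n ^ n * (y zero + ∑ t) ^ suc n           ∎)
  where
  open ≤-Reasoning
  t = y ∘ suc
  regroup : ∀ a b c d → a * (b * (c * d)) ≡ b * (a * d * c)
  regroup = solve-∀

∑-mono-≤ : ∀ {n} {f g : Fin n → ℕ} → (∀ v → f v ≤ g v) → ∑ f ≤ ∑ g
∑-mono-≤ {zero}  _   = z≤n
∑-mono-≤ {suc n} f≤g = +-mono-≤ (f≤g zero) (∑-mono-≤ (f≤g ∘ suc))

∏-const : ∀ n c → ∏ {n} (const c) ≡ c ^ n
∏-const zero    c = refl
∏-const (suc n) c = cong (c *_) (∏-const n c)

∏-nonZero : ∀ {n} (f : Fin n → ℕ) → (∀ v → NonZero (f v)) → NonZero (∏ f)
∏-nonZero {zero}  f _  = _
∏-nonZero {suc n} f nz = m*n≢0 (f zero) (∏ (f ∘ suc)) {{nz zero}} {{∏-nonZero (f ∘ suc) (nz ∘ suc)}}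

product-tabulate : ∀ {n} (f : Fin n → ℕ) → product (List.tabulate f) ≡ ∏ f
product-tabulate {zero}  f = refl
product-tabulate {suc n} f = cong (f zero *_) (product-tabulate (f ∘ suc))

product-allFin : ∀ n (f : Fin n → ℕ) → product (map f (allFin n)) ≡ ∏ f
product-allFin n f = trans (cong product (map-tabulate id f)) (product-tabulate f)

-- Subsets of [n] are Boolean predicates here, so that intersections compute pointwise;
-- Vec.tabulate turns them into the Subset n of the statement.
_↾_ : ∀ {n} → (Fin n → ℕ) → (Fin n → Bool) → Fin n → ℕ
(w ↾ S) v = if S v then w v else 0

weight : ∀ {n} → (Fin n → ℕ) → (Fin n → Bool) → ℕ
weight w S = ∑ (w ↾ S)

size : ∀ {n} → (Fin n → Bool) → ℕ
size = weight (const 1)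

↾-↾ : ∀ {n} (w : Fin n → ℕ) S T → (w ↾ T) ↾ S ≗ w ↾ (λ v → S v ∧ T v)
↾-↾ w S T v with S v
... | true  = refl
... | false = refl

*-weight : ∀ {n} k (w : Fin n → ℕ) S → k * weight w S ≡ weight (λ v → k * w v) S
*-weight k w S = trans (*-distribˡ-sum k (w ↾ S)) (∑-cong pointwise)
  where
  pointwise : ∀ v → k * (w ↾ S) v ≡ ((λ v → k * w v) ↾ S) v
  pointwise v with S v
  ... | true  = refl
  ... | false = *-zeroʳ k

weight-mono-≤ : ∀ {n} {w w′ : Fin n → ℕ} S → (∀ v → S v ≡ true → w v ≤ w′ v) → weight w S ≤ weight w′ S
weight-mono-≤ {w = w} {w′} S w≤w′ = ∑-mono-≤ pointwise
  where
  pointwise : ∀ v → (w ↾ S) v ≤ (w′ ↾ S) v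
  pointwise v with S v in Sv
  ... | true  = w≤w′ v Sv
  ... | false = z≤n

size≡0⇒weight≡0 : ∀ {n} (w : Fin n → ℕ) S → size S ≡ 0 → weight w S ≡ 0
size≡0⇒weight≡0 {zero}  w S _ = refl
size≡0⇒weight≡0 {suc n} w S empty with S zero
... | true  = contradiction empty 1+n≢0
... | false = size≡0⇒weight≡0 (w ∘ suc) (S ∘ suc) empty

weight-≤-averaging : ∀ {n} (w : Fin n → ℕ) M S → (∀ v → S v ≡ true → size S * w v ≤ M) → weight w S ≤ M
weight-≤-averaging w M S bound with size S in eq
... | zero  = subst (_≤ M) (sym (size≡0⇒weight≡0 w S eq)) z≤n
... | suc k = *-cancelˡ-≤ (suc k) (begin
  suc k * weight w S             ≡⟨ *-weight (suc k) w S ⟩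
  weight (λ v → suc k * w v) S   ≤⟨ weight-mono-≤ S (λ v Sv → ≤-trans (bound v Sv) (≤-reflexive (sym (*-identityʳ M)))) ⟩
  weight (λ v → M * 1) S         ≡⟨ *-weight M (const 1) S ⟨
  M * size S                     ≡⟨ cong (M *_) eq ⟩
  M * suc k                      ≡⟨ *-comm M (suc k) ⟩
  suc k * M                      ∎)
  where open ≤-Reasoning

IndependentIn : ∀ {n} → (Fin n → Fin n → Bool) → (Fin n → Bool) → Set
IndependentIn E S = ∀ i j → S i ≡ true → S j ≡ true → E i j ≡ false

Covers : ∀ {n} → List (BipGraph n) → (Fin n → Fin n → Bool) → Set
Covers Hs E = ∀ i j → E i j ≡ true → Any (λ H → BipGraph.adj H i j ≡ true) Hs

_∖_ : ∀ {n} → (Fin n → Fin n → Bool) → BipGraph n → Fin n → Fin n → Bool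
(E ∖ H) i j = E i j ∧ not (BipGraph.adj H i j)

Covers-∖ : ∀ {n} {H : BipGraph n} {Hs E} → Covers (H ∷ Hs) E → Covers Hs (E ∖ H)
Covers-∖ cov i j e with cov i j (∧-conicalˡ _ _ e)
... | here  h = contradiction (subst (λ x → not x ≡ true) h (∧-conicalʳ _ _ e)) λ ()
... | there c = c

keep : ∀ {n} → BipGraph n → Bool → Fin n → Bool
keep H b v = not (lookup (BipGraph.verts H) v) ∨ (BipGraph.side H v xor b)

xor≡true⇒≡not : ∀ x y → x xor y ≡ true → x ≡ not y
xor≡true⇒≡not true  false _ = refl
xor≡true⇒≡not false true  _ = refl
xor≡true⇒≡not true  true  ()
xor≡true⇒≡not false false ()

keep-side : ∀ {n} (H : BipGraph n) b {v} → v ∈ BipGraph.verts H → keep H b v ≡ true → BipGraph.side H v ≡ not b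
keep-side H b {v} v∈H kept =
  xor≡true⇒≡not _ b (subst (λ x → not x ∨ (BipGraph.side H v xor b) ≡ true) ([]=⇒lookup v∈H) kept)

independent-keep : ∀ {n} (H : BipGraph n) b {E S} →
  IndependentIn (E ∖ H) S → IndependentIn E (λ v → S v ∧ keep H b v)
independent-keep H b {E} {S} indep i j i∈ j∈ with E i j in eᵢⱼ | BipGraph.adj H i j in hᵢⱼ
... | false | _     = refl
... | true  | false = contradiction (trans (sym (indep i j (∧-conicalˡ _ _ i∈) (∧-conicalˡ _ _ j∈)))
                                           (cong₂ (λ e h → e ∧ not h) eᵢⱼ hᵢⱼ)) λ ()
... | true  | true  = ⊥-elim (H.edge-bip i j hᵢⱼ (trans (keep-side H b i∈H (∧-conicalʳ _ _ i∈))
                                                        (sym (keep-side H b j∈H (∧-conicalʳ _ _ j∈)))))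
  where
  module H = BipGraph H
  i∈H = proj₁ (H.edge-in i j hᵢⱼ)
  j∈H = proj₂ (H.edge-in i j hᵢⱼ)

outsideFactor : ∀ {n} → Subset n → Fin n → ℕ
outsideFactor p v = if lookup p v then 1 else 2

outsideFactor-split : ∀ {n} (H : BipGraph n) (w : Fin n → ℕ) v →
  outsideFactor (BipGraph.verts H) v * w v ≡ (w ↾ keep H true) v + (w ↾ keep H false) v
outsideFactor-split H w v with lookup (BipGraph.verts H) v | BipGraph.side H v
... | true  | true  = +-identityʳ (w v)
... | true  | false = refl
... | false | _     = cong (w v +_) (+-identityʳ (w v))

-- survivalCount Hs v = 2 ^ (number of H ∈ Hs missing v): the number of ways to choose a side
-- b of every H ∈ Hs such that keep H b v holds throughout.
survivalCount : ∀ {n} → List (BipGraph n) → Fin n → ℕ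
survivalCount Hs v = product (map (λ H → outsideFactor (BipGraph.verts H) v) Hs)

sampling-bound : ∀ {n} (Hs : List (BipGraph n)) {E} → Covers Hs E →
  (w : Fin n → ℕ) (M : ℕ) → (∀ S → IndependentIn E S → weight w S ≤ M) →
  ∑ (λ v → survivalCount Hs v * w v) ≤ 2 ^ length Hs * M
sampling-bound [] {E} cov w M bound = begin
  ∑ (λ v → 1 * w v)      ≡⟨ ∑-cong (*-identityˡ ∘ w) ⟩
  weight w (const true)  ≤⟨ bound (const true) edgeless ⟩
  M                      ≡⟨ *-identityˡ M ⟨
  1 * M                  ∎
  where
  open ≤-Reasoning
  edgeless : IndependentIn E (const true)
  edgeless i j _ _ with E i j in e
  ... | true  = contradiction (cov i j e) ¬Any[]
  ... | false = refl
sampling-bound (H ∷ Hs) cov w M bound = begin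
  ∑ (λ v → survivalCount (H ∷ Hs) v * w v)                        ≡⟨ ∑-cong split ⟩
  ∑ (λ v → survivors true v + survivors false v)                  ≡⟨ ∑-distrib-+ (survivors true) (survivors false) ⟩
  ∑ (survivors true) + ∑ (survivors false)                        ≤⟨ +-mono-≤ (halve true) (halve false) ⟩
  2 ^ length Hs * M + 2 ^ length Hs * M                           ≡⟨ double (2 ^ length Hs) M ⟩
  2 ^ length (H ∷ Hs) * M                                         ∎
  where
  open ≤-Reasoning
  survivors : Bool → Fin _ → ℕ
  survivors b v = survivalCount Hs v * (w ↾ keep H b) v
  halve : ∀ b → ∑ (survivors b) ≤ 2 ^ length Hs * M
  halve b = sampling-bound Hs (Covers-∖ cov) (w ↾ keep H b) M λ S indep →
    ≤-trans (≤-reflexive (∑-cong (↾-↾ w S (keep H b)))) (bound _ (independent-keep H b indep))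
  split : ∀ v → survivalCount (H ∷ Hs) v * w v ≡ survivors true v + survivors false v
  split v = trans (*-swap (outsideFactor (BipGraph.verts H) v) (survivalCount Hs v) (w v))
                  (trans (cong (survivalCount Hs v *_) (outsideFactor-split H w v)) (*-distribˡ-+ (survivalCount Hs v) _ _))
    where
    *-swap : ∀ a b c → a * b * c ≡ b * (a * c)
    *-swap = solve-∀
  double : ∀ a M → a * M + a * M ≡ 2 * a * M
  double = solve-∀

∏-outsideFactor : ∀ {n} (p : Subset n) → ∏ (outsideFactor p) * 2 ^ ∣ p ∣ ≡ 2 ^ n
∏-outsideFactor Vec.[]          = refl
∏-outsideFactor (true  Vec.∷ p) = trans (regroup (∏ (outsideFactor p)) (2 ^ ∣ p ∣)) (cong (2 *_) (∏-outsideFactor p))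
  where
  regroup : ∀ a b → 1 * a * (2 * b) ≡ 2 * (a * b)
  regroup = solve-∀
∏-outsideFactor (false Vec.∷ p) = trans (*-assoc 2 (∏ (outsideFactor p)) (2 ^ ∣ p ∣)) (cong (2 *_) (∏-outsideFactor p))

∏-survivalCount : ∀ {n} (Hs : List (BipGraph n)) → ∏ (survivalCount Hs) * 2 ^ cap Hs ≡ 2 ^ (length Hs * n)
∏-survivalCount {n} []       = trans (*-identityʳ _) (trans (∏-const n 1) (^-zeroˡ n))
∏-survivalCount {n} (H ∷ Hs) = begin
  ∏ (λ v → o v * s v) * 2 ^ (∣ p ∣ + cap Hs)      ≡⟨ cong₂ _*_ (∏-distrib-* o s) (^-distribˡ-+-* 2 ∣ p ∣ (cap Hs)) ⟩
  (∏ o * ∏ s) * (2 ^ ∣ p ∣ * 2 ^ cap Hs)         ≡⟨ interchange (∏ o) (∏ s) _ _ ⟩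
  (∏ o * 2 ^ ∣ p ∣) * (∏ s * 2 ^ cap Hs)         ≡⟨ cong₂ _*_ (∏-outsideFactor p) (∏-survivalCount Hs) ⟩
  2 ^ n * 2 ^ (length Hs * n)                    ≡⟨ ^-distribˡ-+-* 2 n (length Hs * n) ⟨
  2 ^ (n + length Hs * n)                        ∎
  where
  open ≡-Reasoning
  p = BipGraph.verts H
  o = outsideFactor p
  s = survivalCount Hs
  interchange : ∀ a b c d → (a * b) * (c * d) ≡ (a * c) * (b * d)
  interchange = solve-∀

cofactor : ∀ {n} → (Fin n → ℕ) → Fin n → ℕ
cofactor {suc n} α v = ∏ (removeAt α v)

*-cofactor : ∀ {n} (α : Fin n → ℕ) v → α v * cofactor α v ≡ ∏ α
*-cofactor {suc n} α v = sym (∏-remove α)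

∏-cofactor : ∀ {n} (α : Fin n → ℕ) → ∏ (cofactor α) * ∏ α ≡ ∏ α ^ n
∏-cofactor {n} α = begin
  ∏ (cofactor α) * ∏ α               ≡⟨ ∏-distrib-* (cofactor α) α ⟨
  ∏ (λ v → cofactor α v * α v)       ≡⟨ ∏-cong (λ v → trans (*-comm (cofactor α v) (α v)) (*-cofactor α v)) ⟩
  ∏ {n} (const (∏ α))                ≡⟨ ∏-const n (∏ α) ⟩
  ∏ α ^ n                            ∎
  where open ≡-Reasoning

∈-tabulate⁺ : ∀ {n} {S : Fin n → Bool} {v} → S v ≡ true → v ∈ Vec.tabulate S
∈-tabulate⁺ {S = S} {v} Sv = lookup⇒[]= v (Vec.tabulate S) (trans (lookup∘tabulate S v) Sv)

∈-tabulate⁻ : ∀ {n} {S : Fin n → Bool} {v} → v ∈ Vec.tabulate S → S v ≡ true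
∈-tabulate⁻ {S = S} {v} v∈ = trans (sym (lookup∘tabulate S v)) ([]=⇒lookup v∈)

∣tabulate∣≡size : ∀ {n} (S : Fin n → Bool) → ∣ Vec.tabulate S ∣ ≡ size S
∣tabulate∣≡size {zero}  S = refl
∣tabulate∣≡size {suc n} S with S zero
... | true  = cong suc (∣tabulate∣≡size (S ∘ suc))
... | false = ∣tabulate∣≡size (S ∘ suc)

maxIndepThrough-nonZero : ∀ {n} (G : Graph n) {i a} → IsMaxIndepThrough G i a → NonZero a
maxIndepThrough-nonZero G {i} (_ , maximal) =
  >-nonZero (subst (_≤ _) (∣⁅x⁆∣≡1 i) (maximal ⁅ i ⁆ singleton (x∈⁅x⁆ i)))
  where
  singleton : Independent G ⁅ i ⁆
  singleton j k j∈ k∈ rewrite x∈⁅y⁆⇒x≡y i j∈ | x∈⁅y⁆⇒x≡y i k∈ = Graph.irrefl G i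

cofactor-weight-≤ : ∀ {n} (G : Graph n) (α : Fin n → ℕ) → (∀ i → IsMaxIndepThrough G i (α i)) →
  ∀ S → IndependentIn (Graph.adj G) S → weight (cofactor α) S ≤ ∏ α
cofactor-weight-≤ G α maxIndep S indep = weight-≤-averaging (cofactor α) (∏ α) S λ v Sv → begin
  size S * cofactor α v  ≤⟨ *-monoˡ-≤ (cofactor α v) (size≤α Sv) ⟩
  α v * cofactor α v     ≡⟨ *-cofactor α v ⟩
  ∏ α                    ∎
  where
  open ≤-Reasoning
  size≤α : ∀ {v} → S v ≡ true → size S ≤ α v
  size≤α {v} Sv = subst (_≤ α v) (∣tabulate∣≡size S) (proj₂ (maxIndep v) (Vec.tabulate S)
    (λ i j i∈ j∈ → indep i j (∈-tabulate⁻ i∈) (∈-tabulate⁻ j∈)) (∈-tabulate⁺ Sv))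

∏-survivalCount*cofactor : ∀ {n} (Hs : List (BipGraph n)) (α : Fin n → ℕ) →
  ∏ (λ v → survivalCount Hs v * cofactor α v) * (2 ^ cap Hs * ∏ α) ≡ 2 ^ (length Hs * n) * ∏ α ^ n
∏-survivalCount*cofactor {n} Hs α = begin
  ∏ (λ v → survivalCount Hs v * cofactor α v) * (2 ^ cap Hs * ∏ α)
    ≡⟨ cong (_* (2 ^ cap Hs * ∏ α)) (∏-distrib-* (survivalCount Hs) (cofactor α)) ⟩
  ∏ (survivalCount Hs) * ∏ (cofactor α) * (2 ^ cap Hs * ∏ α)
    ≡⟨ interchange (∏ (survivalCount Hs)) (∏ (cofactor α)) (2 ^ cap Hs) (∏ α) ⟩
  ∏ (survivalCount Hs) * 2 ^ cap Hs * (∏ (cofactor α) * ∏ α)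
    ≡⟨ cong₂ _*_ (∏-survivalCount Hs) (∏-cofactor α) ⟩
  2 ^ (length Hs * n) * ∏ α ^ n ∎
  where
  open ≡-Reasoning
  interchange : ∀ a b c d → (a * b) * (c * d) ≡ (a * c) * (b * d)
  interchange = solve-∀

theorem1p4 : (n : ℕ) (G : Graph n) (α : Fin n → ℕ) →
    (∀ i → IsMaxIndepThrough G i (α i)) →
    (Hs : List (BipGraph n)) → IsBipCovering G Hs →
    n ^ n ≤ 2 ^ cap Hs * product (map α (allFin n))
theorem1p4 n G α maxIndep Hs cov = subst (λ P → n ^ n ≤ 2 ^ cap Hs * P) (sym (product-allFin n α))
  (*-cancelˡ-≤ X {{X≢0}} (begin
    X * n ^ n                           ≡⟨ *-comm X (n ^ n) ⟩
    n ^ n * X                           ≡⟨ cong (n ^ n *_) (∏-survivalCount*cofactor Hs α) ⟨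
    n ^ n * (∏ y * (2 ^ cap Hs * P))    ≡⟨ *-assoc (n ^ n) (∏ y) _ ⟨
    n ^ n * ∏ y * (2 ^ cap Hs * P)      ≤⟨ *-monoˡ-≤ (2 ^ cap Hs * P) (AM-GM n y) ⟩
    ∑ y ^ n * (2 ^ cap Hs * P)          ≤⟨ *-monoˡ-≤ (2 ^ cap Hs * P) (^-monoˡ-≤ n ∑y≤2^m*P) ⟩
    (2 ^ m * P) ^ n * (2 ^ cap Hs * P)  ≡⟨ cong (_* (2 ^ cap Hs * P)) [2^m*P]^n≡X ⟩
    X * (2 ^ cap Hs * P)                ∎))
  where
  open ≤-Reasoning
  P = ∏ α
  m = length Hs
  X = 2 ^ (m * n) * P ^ n
  y : Fin n → ℕ
  y v = survivalCount Hs v * cofactor α v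
  ∑y≤2^m*P : ∑ y ≤ 2 ^ m * P
  ∑y≤2^m*P = sampling-bound Hs cov (cofactor α) P (cofactor-weight-≤ G α maxIndep)
  [2^m*P]^n≡X : (2 ^ m * P) ^ n ≡ X
  [2^m*P]^n≡X = trans (^-distribʳ-* (2 ^ m) P n) (cong (_* P ^ n) (^-*-assoc 2 m n))
  X≢0 : NonZero X
  X≢0 = m*n≢0 _ _ {{m^n≢0 2 (m * n)}} {{m^n≢0 P n {{∏-nonZero α (maxIndepThrough-nonZero G ∘ maxIndep)}}}}
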